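{- Let $G=(V,E)$ be a finite simple graph on $n\geq 2$ vertices and let $X$ be a nonempty proper subset of $V$ with $\min\{\mathrm{vol}_G(X),\mathrm{vol}_G(\bar X)\}>0$. If $h_G(X)<\frac{1}{\lfloor n/2\rfloor}$, then $i_G(X)<1$.
   Context: For $X\subseteq V$ write $\bar X=V\setminus X$ and $\partial_G(X)$ for the set of edges of $G$ with one endpoint in $X$ and the other in $\bar X$. The isoperimetric number of a nonempty proper subset $X$ is $i_G(X)=\frac{|\partial_G(X)|}{\min\{|X|,|\bar X|\}}$. The volume of $X$ is $\mathrm{vol}_G(X)=\sum_{x\in X}\deg_G(x)$, and the Cheeger ratio of $X$ is $h_G(X)=\frac{|\partial_G(X)|}{\min\{\mathrm{vol}_G(X),\mathrm{vol}_G(\bar X)\}}$. -}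

module Defs where

open import Data.Nat using (ℕ; zero; suc; _+_; _*_; _⊓_; _/_)
open import Data.Bool using (Bool; true; false; if_then_else_; _∧_; not)
open import Data.Fin using (Fin)
open import Data.Integer using (+_)
open import Data.Rational using (ℚ; 0ℚ)
import Data.Rational as ℚ
open import Relation.Binary.PropositionalEquality using (_≡_)
open import Data.Product using (_×_)

Σ[_] : ∀ {n} → (Fin n → ℕ) → ℕ
Σ[_] {zero}  f = 0
Σ[_] {suc n} f = f Fin.zero + Σ[_] {n} (λ i → f (Fin.suc i))

count : ∀ {n} → (Fin n → Bool) → ℕ
count P = Σ[ (λ i → if P i then 1 else 0) ]

record Graph (n : ℕ) : Set where
  field
    adj   : Fin n → Fin n → Bool
    sym   : ∀ x y → adj x y ≡ adj y x
    irrefl : ∀ x → adj x x ≡ false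

open Graph public

VSubset : ℕ → Set
VSubset n = Fin n → Bool

complement : ∀ {n} → VSubset n → VSubset n
complement X x = not (X x)

card : ∀ {n} → VSubset n → ℕ
card X = count X

NonemptyProper : ∀ {n} → VSubset n → Set
NonemptyProper X = (card X Data.Nat.≥ 1) × (card (complement X) Data.Nat.≥ 1)
  where import Data.Nat

deg : ∀ {n} → Graph n → Fin n → ℕ
deg G x = count (adj G x)

vol : ∀ {n} → Graph n → VSubset n → ℕ
vol G X = Σ[ (λ x → if X x then deg G x else 0) ]

-- |∂(X)|: each edge with one endpoint in X and the other outside is
-- counted exactly once, via its endpoint x ∈ X.
boundary : ∀ {n} → Graph n → VSubset n → ℕ
boundary G X = Σ[ (λ x → if X x then count (λ y → adj G x y ∧ not (X y)) else 0) ]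

-- a / b as a rational number; returns 0 when b = 0 (never used in that
-- case under the hypotheses of the statements).
frac : ℕ → ℕ → ℚ
frac a zero    = 0ℚ
frac a (suc b) = (+ a) ℚ./ suc b

iso : ∀ {n} → Graph n → VSubset n → ℚ
iso G X = frac (boundary G X) (card X ⊓ card (complement X))

cheeger : ∀ {n} → Graph n → VSubset n → ℚ
cheeger G X = frac (boundary G X) (vol G X ⊓ vol G (complement X))

-- A vertex of Y has fewer than |Y| neighbours inside Y, so vol Y + |Y| ≤ |Y|² + |∂Y|.
-- If |∂Y| ≥ |Y| ≥ 1 this forces vol Y ≤ |∂Y| |Y|. Apply this to the side Y of smaller
-- cardinality m ≤ ⌊n/2⌋ (∂ is the same for X and X̄): if i(X) ≥ 1, i.e. |∂X| ≥ m, then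
-- min(vol X, vol X̄) ≤ vol Y ≤ |∂X| ⌊n/2⌋, which is h(X) ≥ 1/⌊n/2⌋.
module Submission where

open import Defs
open import Data.Nat using (ℕ; _≥_; _⊓_; _/_; _<_)
open import Data.Integer using (+_)
import Data.Rational as ℚ

open import Data.Bool using (Bool; true; false; if_then_else_; _∧_; not)
open import Data.Fin using (Fin; zero; suc)
open import Data.Nat using (zero; suc; _+_; _*_; _≤_; z≤n; s≤s; >-nonZero)
open import Data.Nat.DivMod using (m*n/n≡m; /-monoˡ-≤)
open import Data.Nat.Properties
open import Algebra.Properties.CommutativeMonoid.Sum +-0-commutativeMonoid
  using (sum; ∑-distrib-+; ∑-comm)
open import Data.Nat.Tactic.RingSolver using (solve)
open import Data.List using ([]; _∷_)
open import Data.Product using (_,_)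
open import Data.Sum using ([_,_]′)
open import Relation.Binary.PropositionalEquality
  using (_≡_; refl; trans; cong; cong₂; subst; subst₂; module ≡-Reasoning)
import Relation.Binary.PropositionalEquality as ≡
open import Relation.Nullary using (yes; no; contradiction)
import Data.Integer.Properties as ℤ
import Data.Rational.Properties as ℚ
import Data.Rational.Unnormalised as ℚᵘ
import Data.Rational.Unnormalised.Properties as ℚᵘ

indicator : Bool → ℕ
indicator b = if b then 1 else 0

Σ≡sum : ∀ {n} (f : Fin n → ℕ) → Σ[ f ] ≡ sum f
Σ≡sum {zero}  f = refl
Σ≡sum {suc n} f = cong (_+_ (f zero)) (Σ≡sum (λ i → f (suc i)))

Σ-cong : ∀ {n} {f g : Fin n → ℕ} → (∀ i → f i ≡ g i) → Σ[ f ] ≡ Σ[ g ]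
Σ-cong {zero}  eq = refl
Σ-cong {suc n} eq = cong₂ _+_ (eq zero) (Σ-cong (λ i → eq (suc i)))

Σ-mono-≤ : ∀ {n} {f g : Fin n → ℕ} → (∀ i → f i ≤ g i) → Σ[ f ] ≤ Σ[ g ]
Σ-mono-≤ {zero}  le = z≤n
Σ-mono-≤ {suc n} le = +-mono-≤ (le zero) (Σ-mono-≤ (λ i → le (suc i)))

Σ-distrib-+ : ∀ {n} (f g : Fin n → ℕ) → Σ[ (λ i → f i + g i) ] ≡ Σ[ f ] + Σ[ g ]
Σ-distrib-+ f g
  rewrite Σ≡sum (λ i → f i + g i) | Σ≡sum f | Σ≡sum g = ∑-distrib-+ f g

Σ-comm : ∀ {m n} (f : Fin m → Fin n → ℕ) →
  Σ[ (λ i → Σ[ f i ]) ] ≡ Σ[ (λ j → Σ[ (λ i → f i j) ]) ]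
Σ-comm f = begin
  Σ[ (λ i → Σ[ f i ]) ]              ≡⟨ Σ-cong (λ i → Σ≡sum (f i)) ⟩
  Σ[ (λ i → sum (f i)) ]             ≡⟨ Σ≡sum (λ i → sum (f i)) ⟩
  sum (λ i → sum (f i))              ≡⟨ ∑-comm f ⟩
  sum (λ j → sum (λ i → f i j))      ≡⟨ Σ≡sum (λ j → sum (λ i → f i j)) ⟨
  Σ[ (λ j → sum (λ i → f i j)) ]     ≡⟨ Σ-cong (λ j → Σ≡sum (λ i → f i j)) ⟨
  Σ[ (λ j → Σ[ (λ i → f i j) ]) ]    ∎
  where open ≡-Reasoning

Σ-zero : ∀ {n} → Σ[ (λ (i : Fin n) → 0) ] ≡ 0
Σ-zero {zero}  = refl
Σ-zero {suc n} = Σ-zero {n}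

Σ-one : ∀ n → Σ[ (λ (i : Fin n) → 1) ] ≡ n
Σ-one zero    = refl
Σ-one (suc n) = cong suc (Σ-one n)

Σ-if-const : ∀ {n} (P : Fin n → Bool) (c : ℕ) →
  Σ[ (λ i → if P i then c else 0) ] ≡ count P * c
Σ-if-const {zero}  P c = refl
Σ-if-const {suc n} P c with P zero
... | true  = cong (_+_ c) (Σ-if-const (λ i → P (suc i)) c)
... | false = Σ-if-const (λ i → P (suc i)) c

count-split : ∀ {n} (P Q : Fin n → Bool) →
  count P ≡ count (λ i → P i ∧ Q i) + count (λ i → P i ∧ not (Q i))
count-split P Q = trans (Σ-cong (λ i → split (P i) (Q i)))
  (Σ-distrib-+ (λ i → indicator (P i ∧ Q i)) (λ i → indicator (P i ∧ not (Q i))))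
  where
  split : ∀ a b → indicator a ≡ indicator (a ∧ b) + indicator (a ∧ not b)
  split true  true  = refl
  split true  false = refl
  split false b     = refl

count-mono-< : ∀ {n} {P Q : Fin n → Bool} →
  (∀ i → indicator (P i) ≤ indicator (Q i)) →
  (x : Fin n) → P x ≡ false → Q x ≡ true → count P < count Q
count-mono-< le zero Px Qx rewrite Px | Qx = s≤s (Σ-mono-≤ (λ i → le (suc i)))
count-mono-< {P = P} le (suc x) Px Qx =
  ≤-trans (≤-reflexive (≡.sym (+-suc (indicator (P zero)) _)))
          (+-mono-≤ (le zero) (count-mono-< (λ i → le (suc i)) x Px Qx))

card+card-complement : ∀ {n} (X : VSubset n) → card X + card (complement X) ≡ n
card+card-complement {n} X = begin
  card X + card (complement X)
    ≡⟨ Σ-distrib-+ (λ i → indicator (X i)) (λ i → indicator (not (X i))) ⟨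
  Σ[ (λ i → indicator (X i) + indicator (not (X i))) ]
    ≡⟨ Σ-cong (λ i → partition (X i)) ⟩
  Σ[ (λ (i : Fin n) → 1) ]
    ≡⟨ Σ-one n ⟩
  n ∎
  where
  open ≡-Reasoning
  partition : ∀ b → indicator b + indicator (not b) ≡ 1
  partition true  = refl
  partition false = refl

min-card≤half : ∀ {n} (X : VSubset n) → card X ⊓ card (complement X) ≤ n / 2
min-card≤half {n} X = begin
  m              ≡⟨ m*n/n≡m m 2 ⟨
  m * 2 / 2      ≤⟨ /-monoˡ-≤ 2 twice-m≤n ⟩
  n / 2          ∎
  where
  open ≤-Reasoning
  m = card X ⊓ card (complement X)
  twice-m≤n : m * 2 ≤ n
  twice-m≤n = begin
    m * 2                           ≡⟨ *-comm m 2 ⟩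
    m + (m + 0)                     ≡⟨ cong (_+_ m) (+-identityʳ m) ⟩
    m + m                           ≤⟨ +-mono-≤ (m⊓n≤m (card X) _) (m⊓n≤n _ (card (complement X))) ⟩
    card X + card (complement X)    ≡⟨ card+card-complement X ⟩
    n                               ∎

indicator-∧-≤ʳ : ∀ a b → indicator (a ∧ b) ≤ indicator b
indicator-∧-≤ʳ true  b = ≤-refl
indicator-∧-≤ʳ false b = z≤n

module _ {n} (G : Graph n) where

  neighbours-inside : VSubset n → Fin n → ℕ
  neighbours-inside Y x = count (λ y → adj G x y ∧ Y y)

  neighbours-outside : VSubset n → Fin n → ℕ
  neighbours-outside Y x = count (λ y → adj G x y ∧ not (Y y))

  neighbours-inside<card : (Y : VSubset n) (x : Fin n) → Y x ≡ true →
    neighbours-inside Y x < card Y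
  neighbours-inside<card Y x Yx =
    count-mono-< (λ y → indicator-∧-≤ʳ (adj G x y) (Y y)) x (cong (_∧ Y x) (irrefl G x)) Yx

  vol+card≤card²+boundary : (Y : VSubset n) → vol G Y + card Y ≤ card Y * card Y + boundary G Y
  vol+card≤card²+boundary Y = begin
    vol G Y + card Y
      ≡⟨ Σ-distrib-+ (λ x → if Y x then deg G x else 0) (λ x → indicator (Y x)) ⟨
    Σ[ (λ x → (if Y x then deg G x else 0) + indicator (Y x)) ]
      ≤⟨ Σ-mono-≤ pointwise ⟩
    Σ[ (λ x → (if Y x then card Y else 0) + (if Y x then neighbours-outside Y x else 0)) ]
      ≡⟨ Σ-distrib-+ (λ x → if Y x then card Y else 0) (λ x → if Y x then neighbours-outside Y x else 0) ⟩
    Σ[ (λ x → if Y x then card Y else 0) ] + boundary G Y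
      ≡⟨ cong (_+ boundary G Y) (Σ-if-const Y (card Y)) ⟩
    card Y * card Y + boundary G Y ∎
    where
    open ≤-Reasoning
    pointwise : ∀ x → (if Y x then deg G x else 0) + indicator (Y x) ≤
                      (if Y x then card Y else 0) + (if Y x then neighbours-outside Y x else 0)
    pointwise x with Y x in Yx
    ... | false = z≤n
    ... | true  = begin
      deg G x + 1                  ≡⟨ cong (_+ 1) (count-split (adj G x) Y) ⟩
      inside + outside + 1         ≡⟨ +-comm (inside + outside) 1 ⟩
      suc inside + outside         ≤⟨ +-monoˡ-≤ outside (neighbours-inside<card Y x Yx) ⟩
      card Y + outside             ∎
      where
      inside  = neighbours-inside Y x
      outside = neighbours-outside Y x

  crossing : VSubset n → Fin n → Fin n → Bool
  crossing X x y = X x ∧ (adj G x y ∧ not (X y))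

  boundary≡Σ-crossing : (X : VSubset n) →
    boundary G X ≡ Σ[ (λ x → Σ[ (λ y → indicator (crossing X x y)) ]) ]
  boundary≡Σ-crossing X = Σ-cong pointwise
    where
    pointwise : ∀ x → (if X x then neighbours-outside X x else 0) ≡ Σ[ (λ y → indicator (crossing X x y)) ]
    pointwise x with X x
    ... | true  = refl
    ... | false = ≡.sym (Σ-zero {n})

  crossing-complement : (X : VSubset n) (x y : Fin n) →
    indicator (crossing (complement X) x y) ≡ indicator (crossing X y x)
  crossing-complement X x y rewrite Graph.sym G x y = swap (X x) (X y) (adj G y x)
    where
    swap : ∀ a b e → indicator (not a ∧ (e ∧ not (not b))) ≡ indicator (b ∧ (e ∧ not a))
    swap true  true  true  = refl
    swap true  true  false = refl
    swap true  false true  = refl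
    swap true  false false = refl
    swap false true  true  = refl
    swap false true  false = refl
    swap false false true  = refl
    swap false false false = refl

  boundary-complement : (X : VSubset n) → boundary G (complement X) ≡ boundary G X
  boundary-complement X = begin
    boundary G (complement X)
      ≡⟨ boundary≡Σ-crossing (complement X) ⟩
    Σ[ (λ x → Σ[ (λ y → indicator (crossing (complement X) x y)) ]) ]
      ≡⟨ Σ-comm (λ x y → indicator (crossing (complement X) x y)) ⟩
    Σ[ (λ y → Σ[ (λ x → indicator (crossing (complement X) x y)) ]) ]
      ≡⟨ Σ-cong (λ y → Σ-cong (λ x → crossing-complement X x y)) ⟩
    Σ[ (λ y → Σ[ (λ x → indicator (crossing X y x)) ]) ]
      ≡⟨ boundary≡Σ-crossing X ⟨
    boundary G X ∎
    where open ≡-Reasoning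

square+≤mul+ : ∀ {m b} → 1 ≤ m → m ≤ b → m * m + b ≤ b * m + m
square+≤mul+ {m} 1≤m m≤b with t , refl ← m≤n⇒∃[o]m+o≡n m≤b = begin
  m * m + (m + t)       ≡⟨ solve (m ∷ t ∷ []) ⟩
  m * m + m + t         ≤⟨ +-monoʳ-≤ (m * m + m) (m≤m*n t m {{>-nonZero 1≤m}}) ⟩
  m * m + m + t * m     ≡⟨ solve (m ∷ t ∷ []) ⟩
  (m + t) * m + m       ∎
  where open ≤-Reasoning

module _ {n} (G : Graph n) (Y : VSubset n) where

  vol≤boundary*card : 1 ≤ card Y → card Y ≤ boundary G Y → vol G Y ≤ boundary G Y * card Y
  vol≤boundary*card nonempty card≤boundary = +-cancelʳ-≤ (card Y) (vol G Y) (boundary G Y * card Y)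
    (≤-trans (vol+card≤card²+boundary G Y) (square+≤mul+ nonempty card≤boundary))

  boundary<card : ∀ {k} → 1 ≤ card Y → card Y ≤ k → boundary G Y * k < vol G Y →
    boundary G Y < card Y
  boundary<card {k} nonempty card≤k b*k<vol with card Y ≤? boundary G Y
  ... | no  card≰boundary = ≰⇒> card≰boundary
  ... | yes card≤boundary = contradiction b*k<vol (≤⇒≯ (begin
    vol G Y                  ≤⟨ vol≤boundary*card nonempty card≤boundary ⟩
    boundary G Y * card Y    ≤⟨ *-monoʳ-≤ (boundary G Y) card≤k ⟩
    boundary G Y * k         ∎))
    where open ≤-Reasoning

cross-multiply-< : ∀ a b c d → (+ a ℚ./ suc b) ℚ.< (+ c ℚ./ suc d) → a * suc d < c * suc b
cross-multiply-< a b c d p = ℤ.+◃-cancel-< (ℚᵘ.drop-*<* unnormalised-<)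
  where
  unnormalised-< : ℚᵘ.mkℚᵘ (+ a) b ℚᵘ.< ℚᵘ.mkℚᵘ (+ c) d
  unnormalised-< = ℚᵘ.<-respˡ-≃ (ℚ.toℚᵘ-fromℚᵘ (ℚᵘ.mkℚᵘ (+ a) b))
                     (ℚᵘ.<-respʳ-≃ (ℚ.toℚᵘ-fromℚᵘ (ℚᵘ.mkℚᵘ (+ c) d)) (ℚ.toℚᵘ-mono-< p))

frac<frac-one⇒*< : ∀ a v k → 0 < v → frac a v ℚ.< frac 1 k → a * k < v
frac<frac-one⇒*< a (suc v) zero    _ _ rewrite *-zeroʳ a = s≤s z≤n
frac<frac-one⇒*< a (suc v) (suc k) _ p =
  ≤-trans (cross-multiply-< a v 1 k p) (≤-reflexive (+-identityʳ (suc v)))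

<⇒frac<1 : ∀ {a m} → a < m → frac a m ℚ.< ℚ.1ℚ
<⇒frac<1 {a} {suc m} a<m = ℚ.toℚᵘ-cancel-<
  (ℚᵘ.<-respˡ-≃ (ℚᵘ.≃-sym (ℚ.toℚᵘ-fromℚᵘ (ℚᵘ.mkℚᵘ (+ a) m)))
    (ℚᵘ.*<* (ℤ.+◃-mono-< (begin-strict
      a * 1          ≡⟨ *-identityʳ a ⟩
      a              <⟨ a<m ⟩
      suc m          ≡⟨ +-identityʳ (suc m) ⟨
      suc m + 0      ∎))))
  where open ≤-Reasoning

boundary<min-card : ∀ {n} (G : Graph n) (X : VSubset n) → NonemptyProper X →
  boundary G X * (n / 2) < vol G X ⊓ vol G (complement X) →
  boundary G X < card X ⊓ card (complement X)
boundary<min-card {n} G X (X-nonempty , X̄-nonempty) b*k<vol =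
  [ via-X , via-X̄ ]′ (⊓-sel (card X) (card X̄))
  where
  X̄ = complement X
  b = boundary G X
  k = n / 2
  min = card X ⊓ card X̄

  via-X : min ≡ card X → b < min
  via-X min≡X = subst (b <_) (≡.sym min≡X)
    (boundary<card G X X-nonempty (subst (_≤ k) min≡X (min-card≤half X))
      (<-≤-trans b*k<vol (m⊓n≤m (vol G X) (vol G X̄))))

  via-X̄ : min ≡ card X̄ → b < min
  via-X̄ min≡X̄ = subst₂ _<_ (boundary-complement G X) (≡.sym min≡X̄)
    (boundary<card G X̄ X̄-nonempty (subst (_≤ k) min≡X̄ (min-card≤half X))
      (subst (λ β → β * k < vol G X̄) (≡.sym (boundary-complement G X))
        (<-≤-trans b*k<vol (m⊓n≤n (vol G X) (vol G X̄)))))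

lemma2p3 : (n : ℕ) → n ≥ 2 → (G : Graph n) → (X : VSubset n) →
    NonemptyProper X →
    0 < vol G X ⊓ vol G (complement X) →
    cheeger G X ℚ.< frac 1 (n / 2) →
    iso G X ℚ.< ℚ.1ℚ
-- The hypothesis n ≥ 2 is implied by NonemptyProper X.
lemma2p3 n _ G X nonempty-proper 0<vol cheeger<1/k =
  <⇒frac<1 (boundary<min-card G X nonempty-proper
    (frac<frac-one⇒*< (boundary G X) _ (n / 2) 0<vol cheeger<1/k))
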